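{- Let $n\geq 3$ and $m\geq 3$ be odd integers. Then the Dutch windmill graph $D_n^m$ is $\Gamma$-harmonious for every Abelian group $\Gamma$ of order $mn$.
   Context: The Dutch windmill graph $D_n^m$ consists of $m$ copies of the cycle $C_n$ sharing exactly one common vertex (the central vertex) and otherwise vertex-disjoint; it has $mn$ edges. For a graph $G=(V,E)$ with $q$ edges and a finite Abelian group $\Gamma$ of order $q$ (written additively), $G$ is called $\Gamma$-harmonious if there is an injection $f:V\to\Gamma$ such that the induced edge labeling $w(xy)=f(x)+f(y)$ is a bijection from $E$ to $\Gamma$. -}

module Defs where

open import Level using (Level)
open import Data.Nat using (ℕ; zero; suc; _∸_; _<?_; _*_)
open import Data.Fin using (Fin; toℕ; fromℕ<)
open import Data.Product using (_×_; _,_; Σ)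
open import Data.Sum using (_⊎_; inj₁; inj₂)
open import Data.Unit using (⊤; tt)
open import Relation.Nullary using (yes; no)
open import Relation.Binary.PropositionalEquality using (_≡_)
import Relation.Binary.PropositionalEquality as P
open import Function using (Injective; Bijective)
open import Function.Bundles using (Bijection)
open import Algebra.Bundles using (AbelianGroup)

record Graph : Set₁ where
  field
    Vertex : Set
    Edge   : Set
    ends   : Edge → Vertex × Vertex

HasOrder : ∀ {c ℓ} → AbelianGroup c ℓ → ℕ → Set (c Level.⊔ ℓ)
HasOrder Γ q = Bijection (P.setoid (Fin q)) (AbelianGroup.setoid Γ)

IsHarmoniousLabelling : ∀ {c ℓ} (G : Graph) (Γ : AbelianGroup c ℓ) →
  (Graph.Vertex G → AbelianGroup.Carrier Γ) → Set (c Level.⊔ ℓ)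
IsHarmoniousLabelling G Γ f =
  Injective _≡_ _≈_ f ×
  Bijective _≡_ _≈_ (λ e → f (Data.Product.proj₁ (ends e)) ∙ f (Data.Product.proj₂ (ends e)))
  where open Graph G
        open AbelianGroup Γ

IsHarmonious : ∀ {c ℓ} → Graph → AbelianGroup c ℓ → Set (c Level.⊔ ℓ)
IsHarmonious G Γ = Σ (Graph.Vertex G → AbelianGroup.Carrier Γ) (IsHarmoniousLabelling G Γ)

-- Dutch windmill D_n^m: m copies of the cycle C_n sharing one central vertex.
-- Vertices: the centre (inj₁ tt) and, for each copy i, the n-1 non-central
-- vertices inj₂ (i , k), k < n-1.
WVertex : ℕ → ℕ → Set
WVertex n m = ⊤ ⊎ (Fin m × Fin (n ∸ 1))

-- The p-th vertex (0 ≤ p ≤ n) along the i-th cycle; positions 0 and n are the centre.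
cycleVertex : (n : ℕ) {m : ℕ} → Fin m → ℕ → WVertex n m
cycleVertex n i zero = inj₁ tt
cycleVertex n i (suc p) with p <? (n ∸ 1)
... | yes p<n-1 = inj₂ (i , fromℕ< p<n-1)
... | no _      = inj₁ tt

DutchWindmill : ℕ → ℕ → Graph
DutchWindmill n m = record
  { Vertex = WVertex n m
  ; Edge   = Fin m × Fin n
  ; ends   = λ { (i , j) → cycleVertex n i (toℕ j) , cycleVertex n i (suc (toℕ j)) }
  }

{-# OPTIONS --safe #-}
module Submission where

-- Let q = m n. A finite abelian group Γ of order q has a subgroup H of order m (Cauchy's
-- theorem, applied once for every prime factor of m), and Γ / H has odd order n. Extend H by
-- elements k₁ … kₜ, each of relative order Rᵢ over H and its predecessors, until Γ is reached,
-- and let L N be the element whose coordinates along k₁ … kₜ are the mixed-radix digits of N;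
-- then L 0 … L (n - 1) represent the cosets of H. The cyclic sums L N + L (N + 1 mod n) represent distinct cosets
-- too: the leading digit i of N contributes (2 i + carry) k₁ to such a sum, and 2 is invertible
-- modulo the odd R₁. Listing H as h₀ … h_{m-1}, give the centre the label L 0 and the p-th
-- vertex of copy i the label hᵢ + L p. The p-th edge of copy i then gets c hᵢ + L p + L (p + 1
-- mod n) with c ∈ {1, 2}: the coset determines p, and then hᵢ, since multiplication by c is
-- injective on a group of odd order. So the q edge labels are distinct, hence exhaust Γ.

open import Level using (Level; _⊔_)
open import Algebra.Bundles using (AbelianGroup)
open import Data.Fin as Fin using (Fin; toℕ)
import Data.Fin.Properties as Finₚ
open import Data.List using (List; []; _∷_; _∷ʳ_)
open import Data.List.Relation.Unary.All using (All; []; _∷_)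
open import Data.Nat as ℕ using (ℕ; zero; suc; _+_; _*_; _∸_; _≤_; _<_; _≥_; z≤n; s≤s; NonZero)
import Data.Nat.Properties as ℕₚ
open import Data.Nat.Coprimality as Coprimality using (Coprime; coprime-divisor; 1-coprimeTo)
open import Data.Nat.DivMod
  using (_/_; _%_; m≡m%n+[m/n]*n; m%n<n; m<n⇒m%n≡m; m<n⇒m/n≡0; [m+kn]%n≡m%n;
         +-distrib-/-∣ʳ; m*n/n≡m; m<n*o⇒m/o<n; m%[n*o]/o≡m/o%n; m∣n⇒o%n%m≡o%m;
         /-congˡ; %-congˡ; %-distribˡ-*; n%n≡0)
open import Data.Nat.Divisibility
  using (_∣_; divides; _∣?_; ∣-trans; n∣m*n; m∣m*n; *-monoʳ-∣; *-cancelˡ-∣; ∣⇒≤; 0∣⇒≡0;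
         m%n≡0⇒n∣m; n∣m⇒m%n≡0; 1∣_)
open import Data.Nat.ListAction using (product)
open import Data.Nat.Primality using (Prime; euclidsLemma; prime⇒nonTrivial; ¬prime[0])
open import Data.Nat.Primality.Factorisation using (factorise)
open import Data.Nat.Tactic.RingSolver using (solve-∀)
open import Data.Product using (∃; _×_; _,_; proj₁; proj₂)
open import Data.Sum using (_⊎_; inj₁; inj₂; [_,_]′)
open import Function using (id; case_of_)
open import Function.Bundles using (Bijection; Injection; Inverse)
open import Function.Properties.Bijection using (Bijection⇒Inverse)
open import Function.Properties.Inverse using (Inverse⇒Injection)
open import Relation.Binary.Consequences using (wlog)
open import Relation.Binary.PropositionalEquality as ≡ using (_≡_; _≢_; refl)
import Relation.Binary.Reasoning.Setoid
open import Relation.Nullary using (¬_; Dec; yes; no; contradiction)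
open import Relation.Nullary.Decidable using (map′)
open import Relation.Unary using (Decidable)

open import Defs

least-witness : ∀ {p} {P : ℕ → Set p} → Decidable P → ∀ n → P n →
                ∃ λ k → P k × (∀ j → j < k → ¬ P j)
least-witness P? n pn with P? 0
... | yes p0 = 0 , p0 , λ _ ()
least-witness P? zero    p0 | no ¬p0 = contradiction p0 ¬p0
least-witness P? (suc n) pn | no ¬p0 with least-witness (λ k → P? (suc k)) n pn
... | k , pk , below = suc k , pk , λ { zero _ → ¬p0 ; (suc j) (s≤s j<k) → below j j<k }

∣∧<⇒≡0 : ∀ {d R} → R ∣ d → d < R → d ≡ 0
∣∧<⇒≡0 {zero}  _   _   = refl
∣∧<⇒≡0 {suc d} R∣d d<R = contradiction (∣⇒≤ R∣d) (ℕₚ.<⇒≱ d<R)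

¬2∣⇒coprime-2 : ∀ {R} → ¬ 2 ∣ R → Coprime R 2
¬2∣⇒coprime-2 _    {0}                 (_ , 0∣2) = contradiction (0∣⇒≡0 0∣2) λ ()
¬2∣⇒coprime-2 _    {1}                 _         = refl
¬2∣⇒coprime-2 ¬2∣R {2}                 (2∣R , _) = contradiction 2∣R ¬2∣R
¬2∣⇒coprime-2 _    {suc (suc (suc _))} (_ , d∣2) = contradiction (∣⇒≤ d∣2) λ { (s≤s (s≤s ())) }

[j+i*B]/B≡j/B+i : ∀ j i B .{{_ : NonZero B}} → (j + i * B) / B ≡ j / B + i
[j+i*B]/B≡j/B+i j i B = ≡.trans (+-distrib-/-∣ʳ j (n∣m*n i)) (≡.cong (j / B +_) (m*n/n≡m i B))

j+i*B<R*B : ∀ {i j R B} → j < B → i < R → j + i * B < R * B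
j+i*B<R*B {i} {B = B} j<B i<R =
  ℕₚ.<-≤-trans (ℕₚ.+-monoˡ-< (i * B) j<B) (ℕₚ.*-monoˡ-≤ B i<R)

budget-step : ∀ {q a b f} → a < b → q ≤ a + suc f → q ≤ b + f
budget-step {a = a} {f = f} a<b q≤ =
  ℕₚ.≤-trans q≤ (ℕₚ.≤-trans (ℕₚ.≤-reflexive (ℕₚ.+-suc a f)) (ℕₚ.+-monoˡ-≤ f a<b))

prime-∣-cofactor : ∀ {a R q p} .{{_ : NonZero a}} → Prime p → ¬ p ∣ R →
                   a * R ∣ q → a * p ∣ q → a * R * p ∣ q
prime-∣-cofactor {a} {R} {q} {p} p-prime p∤R (divides t q≡t*aR) a*p∣q =
  ≡.subst (a * R * p ∣_) (≡.sym q≡aRt) (*-monoʳ-∣ (a * R) p∣t)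
  where
  q≡aRt : q ≡ a * R * t
  q≡aRt = ≡.trans q≡t*aR (ℕₚ.*-comm t (a * R))
  p∣t : p ∣ t
  p∣t = [ (λ p∣R → contradiction p∣R p∤R) , id ]′ (euclidsLemma R t p-prime
          (*-cancelˡ-∣ a (≡.subst (a * p ∣_) (≡.trans q≡aRt (ℕₚ.*-assoc a R t)) a*p∣q)))

Fin⇒nonZero : ∀ {n} → Fin n → NonZero n
Fin⇒nonZero Fin.zero    = _
Fin⇒nonZero (Fin.suc _) = _

Fin-injective⇒surjective : ∀ {k} (f : Fin k → Fin k) → (∀ {x y} → f x ≡ f y → x ≡ y) →
                           ∀ y → ∃ λ x → f x ≡ y
Fin-injective⇒surjective f f-injective y with Finₚ.any? (λ x → f x Finₚ.≟ y)
... | yes hit = hit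
Fin-injective⇒surjective {suc k} f f-injective y | no miss =
  contradiction (Finₚ.injective⇒≤ f′-injective) (ℕₚ.<-irrefl refl)
  where
  y≢f : ∀ x → y ≢ f x
  y≢f x y≡fx = miss (x , ≡.sym y≡fx)
  f′ : Fin (suc k) → Fin k
  f′ x = Fin.punchOut (y≢f x)
  f′-injective : ∀ {x x′} → f′ x ≡ f′ x′ → x ≡ x′
  f′-injective {x} {x′} eq = f-injective (Finₚ.punchOut-injective (y≢f x) (y≢f x′) eq)

odd⇒nonZero : ∀ {k} → k % 2 ≡ 1 → NonZero k
odd⇒nonZero {suc _} _ = _

odd⇒¬2∣ : ∀ {k} → k % 2 ≡ 1 → ¬ 2 ∣ k
odd⇒¬2∣ {k} k%2≡1 2∣k = contradiction (≡.trans (≡.sym k%2≡1) (n∣m⇒m%n≡0 k 2 2∣k)) λ ()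

odd⇒2∣suc : ∀ {k} → k % 2 ≡ 1 → 2 ∣ suc k
odd⇒2∣suc {k} k%2≡1 =
  divides (suc (k / 2)) (≡.cong suc (≡.trans (m≡m%n+[m/n]*n k 2) (≡.cong (_+ k / 2 * 2) k%2≡1)))

odd*odd : ∀ {k l} → k % 2 ≡ 1 → l % 2 ≡ 1 → (k * l) % 2 ≡ 1
odd*odd {k} {l} k%2≡1 l%2≡1 =
  ≡.trans (%-distribˡ-* k l 2) (≡.cong₂ (λ a b → (a * b) % 2) k%2≡1 l%2≡1)

<∸1⇒suc< : ∀ {t n} .{{_ : NonZero n}} → t < n ∸ 1 → suc t < n
<∸1⇒suc< {n = n} t<n-1 = ≡.subst (_ <_) (ℕₚ.suc-pred n) (s≤s t<n-1)

module AbelianGroupMultiples {c ℓ} (Γ : AbelianGroup c ℓ) where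
  open AbelianGroup Γ public
    renaming (refl to ≈-refl; sym to ≈-sym; trans to ≈-trans; reflexive to ≈-reflexive)
  open import Algebra.Properties.Monoid.Mult monoid public
    using () renaming (_×_ to _·_; ×-homo-1 to ·-identityˡ; ×-homo-+ to ·-homo-+;
                       ×-assocˡ to ·-assoc; ×-congʳ to ·-congʳ; ×-congˡ to ·-congˡ)
  open import Algebra.Properties.CommutativeMonoid.Mult commutativeMonoid public
    using () renaming (×-distrib-+ to ·-distrib-∙)
  open import Algebra.Properties.CommutativeSemigroup commutativeSemigroup public
    using (interchange; x∙yz≈zx∙y)
  open import Algebra.Properties.Group group public using (∙-cancelˡ; ∙-cancelʳ; inverseʳ-unique)
  open import Relation.Binary.Reasoning.Setoid setoid

  ·-comm : ∀ a b x → a · b · x ≈ b · a · x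
  ·-comm a b x = begin
    a · b · x   ≈⟨ ·-assoc x a b ⟩
    (a * b) · x ≈⟨ ·-congˡ (ℕₚ.*-comm a b) ⟩
    (b * a) · x ≈⟨ ·-assoc x b a ⟨
    b · a · x   ∎

module Span {c ℓ} (Γ : AbelianGroup c ℓ) where
  open AbelianGroupMultiples Γ
  open import Relation.Binary.Reasoning.Setoid setoid

  infix 4 _∈⟨_⟩
  data _∈⟨_⟩ : Carrier → List Carrier → Set (c ⊔ ℓ) where
    ∈[] : ∀ {x} → x ≈ ε → x ∈⟨ [] ⟩
    ∈∷  : ∀ {g S x} s k → s ∈⟨ S ⟩ → x ≈ s ∙ k · g → x ∈⟨ g ∷ S ⟩

  ∈-resp-≈ : ∀ {S x y} → x ≈ y → x ∈⟨ S ⟩ → y ∈⟨ S ⟩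
  ∈-resp-≈ x≈y (∈[] x≈ε)         = ∈[] (≈-trans (≈-sym x≈y) x≈ε)
  ∈-resp-≈ x≈y (∈∷ s k s∈ x≈s∙kg) = ∈∷ s k s∈ (≈-trans (≈-sym x≈y) x≈s∙kg)

  ε-∈ : ∀ S → ε ∈⟨ S ⟩
  ε-∈ []      = ∈[] ≈-refl
  ε-∈ (g ∷ S) = ∈∷ ε 0 (ε-∈ S) (≈-sym (identityˡ ε))

  ∙-∈ : ∀ {S x y} → x ∈⟨ S ⟩ → y ∈⟨ S ⟩ → x ∙ y ∈⟨ S ⟩
  ∙-∈ (∈[] x≈ε) (∈[] y≈ε) = ∈[] (≈-trans (∙-cong x≈ε y≈ε) (identityˡ ε))
  ∙-∈ {x = x} {y} (∈∷ {g = g} s k s∈ x≈) (∈∷ s′ k′ s′∈ y≈) =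
    ∈∷ (s ∙ s′) (k + k′) (∙-∈ s∈ s′∈) (begin
      x ∙ y                       ≈⟨ ∙-cong x≈ y≈ ⟩
      (s ∙ k · g) ∙ (s′ ∙ k′ · g) ≈⟨ interchange s (k · g) s′ (k′ · g) ⟩
      (s ∙ s′) ∙ (k · g ∙ k′ · g) ≈⟨ ∙-congˡ (·-homo-+ g k k′) ⟨
      (s ∙ s′) ∙ (k + k′) · g     ∎)

  ·-∈ : ∀ {S x} k → x ∈⟨ S ⟩ → k · x ∈⟨ S ⟩
  ·-∈ {S} zero    _  = ε-∈ S
  ·-∈     (suc k) x∈ = ∙-∈ x∈ (·-∈ k x∈)

  ∈-∷ : ∀ {S x} g → x ∈⟨ S ⟩ → x ∈⟨ g ∷ S ⟩
  ∈-∷ {x = x} g x∈ = ∈∷ x 0 x∈ (≈-sym (identityʳ x))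

  generator-∈ : ∀ {S} g k → k · g ∈⟨ g ∷ S ⟩
  generator-∈ {S} g k = ∈∷ ε k (ε-∈ S) (≈-sym (identityˡ (k · g)))

  ·-∈-∷ : ∀ {S g x} R → R · g ∈⟨ S ⟩ → x ∈⟨ g ∷ S ⟩ → R · x ∈⟨ S ⟩
  ·-∈-∷ {g = g} {x} R Rg∈ (∈∷ s k s∈ x≈) = ∈-resp-≈ (≈-sym Rx≈) (∙-∈ (·-∈ R s∈) (·-∈ k Rg∈))
    where
    Rx≈ : R · x ≈ R · s ∙ k · R · g
    Rx≈ = begin
      R · x             ≈⟨ ·-congʳ R x≈ ⟩
      R · (s ∙ k · g)   ≈⟨ ·-distrib-∙ s (k · g) R ⟩
      R · s ∙ R · k · g ≈⟨ ∙-congˡ (·-comm R k g) ⟩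
      R · s ∙ k · R · g ∎

  record RelativeOrder (S : List Carrier) (g : Carrier) (R : ℕ) : Set (c ⊔ ℓ) where
    field
      kills  : R · g ∈⟨ S ⟩
      ∣-kill : ∀ k → k · g ∈⟨ S ⟩ → R ∣ k

  -- A pair (g , r) stands for a generator g of relative order suc r, so that every index is
  -- visibly nonzero.
  Gens : Set c
  Gens = List (Carrier × ℕ)

  infixl 5 _◂_
  _◂_ : List Carrier → Gens → List Carrier
  S ◂ []            = S
  S ◂ ((g , _) ∷ ks) = (g ∷ S) ◂ ks

  data Series (S : List Carrier) : Gens → Set (c ⊔ ℓ) where
    []  : Series S []
    _∷_ : ∀ {g r ks} → RelativeOrder S g (suc r) → Series (g ∷ S) ks → Series S ((g , r) ∷ ks)

  index : Gens → ℕ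
  index []             = 1
  index ((_ , r) ∷ ks) = suc r * index ks

  index-nonZero : ∀ ks → NonZero (index ks)
  index-nonZero []             = _
  index-nonZero ((_ , r) ∷ ks) = ℕₚ.m*n≢0 (suc r) (index ks) {{_}} {{index-nonZero ks}}

  ◂-∷ʳ : ∀ S ks g r → S ◂ (ks ∷ʳ (g , r)) ≡ g ∷ (S ◂ ks)
  ◂-∷ʳ S []             g r = refl
  ◂-∷ʳ S ((h , _) ∷ ks) g r = ◂-∷ʳ (h ∷ S) ks g r

  index-∷ʳ : ∀ ks g r → index (ks ∷ʳ (g , r)) ≡ index ks * suc r
  index-∷ʳ []             g r = ℕₚ.*-comm (suc r) 1
  index-∷ʳ ((_ , s) ∷ ks) g r =
    ≡.trans (≡.cong (suc s *_) (index-∷ʳ ks g r)) (≡.sym (ℕₚ.*-assoc (suc s) (index ks) (suc r)))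

  index-∷ʳ-* : ∀ ks g r t → index (ks ∷ʳ (g , r)) * t ≡ index ks * (suc r * t)
  index-∷ʳ-* ks g r t = ≡.trans (≡.cong (_* t) (index-∷ʳ ks g r)) (ℕₚ.*-assoc (index ks) (suc r) t)

  Series-∷ʳ : ∀ {S ks g r} → Series S ks → RelativeOrder (S ◂ ks) g (suc r) →
              Series S (ks ∷ʳ (g , r))
  Series-∷ʳ []             ro = ro ∷ []
  Series-∷ʳ (ro′ ∷ series) ro = ro′ ∷ Series-∷ʳ series ro

  ∈-◂ : ∀ {S x} ks → x ∈⟨ S ⟩ → x ∈⟨ S ◂ ks ⟩
  ∈-◂ []             x∈ = x∈
  ∈-◂ ((g , _) ∷ ks) x∈ = ∈-◂ ks (∈-∷ g x∈)

  -- N written in the mixed radix of the relative orders, most significant digit first.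
  rep : Gens → ℕ → Carrier
  rep []             N = ε
  rep ((k , _) ∷ ks) N = (N / index ks) · k ∙ rep ks (N % index ks)
    where instance _ = index-nonZero ks

  rep-∈ : ∀ S ks N → rep ks N ∈⟨ S ◂ ks ⟩
  rep-∈ S []             N = ε-∈ S
  rep-∈ S ((k , _) ∷ ks) N =
    ∙-∈ (∈-◂ ks (generator-∈ k (N / index ks))) (rep-∈ (k ∷ S) ks (N % index ks))
    where instance _ = index-nonZero ks

  rep-digits : ∀ k r ks {i j} → j < index ks →
               rep ((k , r) ∷ ks) (j + i * index ks) ≈ i · k ∙ rep ks j
  rep-digits k r ks {i} {j} j<B =
    ∙-cong (·-congˡ quotient) (≈-reflexive (≡.cong (rep ks) remainder))
    where
    instance _ = index-nonZero ks
    quotient : (j + i * index ks) / index ks ≡ i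
    quotient = ≡.trans ([j+i*B]/B≡j/B+i j i (index ks)) (≡.cong (_+ i) (m<n⇒m/n≡0 j<B))
    remainder : (j + i * index ks) % index ks ≡ j
    remainder = ≡.trans ([m+kn]%n≡m%n j i (index ks)) (m<n⇒m%n≡m j<B)

  relativeOrder-multiple : ∀ {S x p} s .{{_ : NonZero s}} → RelativeOrder S x (s * p) →
                           RelativeOrder S (s · x) p
  relativeOrder-multiple {S} {x} {p} s ro = record
    { kills  = ∈-resp-≈ (≈-sym (≈-trans (·-assoc x p s) (·-congˡ (ℕₚ.*-comm p s)))) kills
    ; ∣-kill = λ k k·s·x∈ → *-cancelˡ-∣ s (≡.subst (s * p ∣_) (ℕₚ.*-comm k s)
                 (∣-kill (k * s) (∈-resp-≈ (·-assoc x k s) k·s·x∈)))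
    }
    where open RelativeOrder ro

  relativeOrder-lift : ∀ {S x y R p} → RelativeOrder S x R → RelativeOrder (x ∷ S) y p →
                       Prime p → ¬ p ∣ R → RelativeOrder S (R · y) p
  relativeOrder-lift {y = y} {R} {p} x-ro y-ro p-prime p∤R = record
    { kills  = ∈-resp-≈ (·-comm R p y) (·-∈-∷ R (kills x-ro) (kills y-ro))
    ; ∣-kill = λ k k·R·y∈ → [ id , (λ p∣R → contradiction p∣R p∤R) ]′ (euclidsLemma k R p-prime
        (∣-kill y-ro (k * R) (∈-∷ _ (∈-resp-≈ (·-assoc y k R) k·R·y∈))))
    }
    where open RelativeOrder

  ∈[]⇒≈ε : ∀ {x} → x ∈⟨ [] ⟩ → x ≈ ε
  ∈[]⇒≈ε (∈[] x≈ε) = x≈ε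

  ∉⇒1<relativeOrder : ∀ {S x r} → ¬ x ∈⟨ S ⟩ → RelativeOrder S x (suc r) → 1 < suc r
  ∉⇒1<relativeOrder {r = zero}  x∉ ro =
    contradiction (∈-resp-≈ (·-identityˡ _) (RelativeOrder.kills ro)) x∉
  ∉⇒1<relativeOrder {r = suc _} _  _  = s≤s (s≤s z≤n)

  IsTorsion : Set (c ⊔ ℓ)
  IsTorsion = ∀ x → ∃ λ d → suc d · x ≈ ε

  infix 4 _≋_[mod_]
  _≋_[mod_] : Carrier → Carrier → List Carrier → Set (c ⊔ ℓ)
  x ≋ y [mod S ] = ∃ λ s → s ∈⟨ S ⟩ × x ≈ y ∙ s

  ≈⇒≋ : ∀ {S x y} → x ≈ y → x ≋ y [mod S ]
  ≈⇒≋ {S} {y = y} x≈y = ε , ε-∈ S , ≈-trans x≈y (≈-sym (identityʳ y))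

  ∈⇒≋ : ∀ {S x s} → s ∈⟨ S ⟩ → x ∙ s ≋ x [mod S ]
  ∈⇒≋ s∈ = _ , s∈ , ≈-refl

  ≋-trans : ∀ {S x y z} → x ≋ y [mod S ] → y ≋ z [mod S ] → x ≋ z [mod S ]
  ≋-trans {z = z} (s , s∈ , x≈) (t , t∈ , y≈) =
    t ∙ s , ∙-∈ t∈ s∈ , ≈-trans x≈ (≈-trans (∙-congʳ y≈) (assoc z t s))

  ∙-≋ : ∀ {S x y u v} → x ≋ y [mod S ] → u ≋ v [mod S ] → x ∙ u ≋ y ∙ v [mod S ]
  ∙-≋ {y = y} {v = v} (s , s∈ , x≈) (t , t∈ , u≈) =
    s ∙ t , ∙-∈ s∈ t∈ , ≈-trans (∙-cong x≈ u≈) (interchange y s v t)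

  ≋-∷ : ∀ {S x y} g → x ≋ y [mod S ] → x ≋ y [mod g ∷ S ]
  ≋-∷ g (s , s∈ , x≈) = s , ∈-∷ g s∈ , x≈

  ≋-∈ : ∀ {S x y} → x ≋ y [mod S ] → y ∈⟨ S ⟩ → x ∈⟨ S ⟩
  ≋-∈ (s , s∈ , x≈) y∈ = ∈-resp-≈ (≈-sym x≈) (∙-∈ y∈ s∈)

  ≋-cancelʳ : ∀ {S x y z} → x ∙ z ≋ y ∙ z [mod S ] → x ≋ y [mod S ]
  ≋-cancelʳ {x = x} {y} {z} (s , s∈ , x∙z≈) = s , s∈ , ∙-cancelʳ z x (y ∙ s) (begin
    x ∙ z       ≈⟨ x∙z≈ ⟩
    y ∙ z ∙ s   ≈⟨ assoc y z s ⟩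
    y ∙ (z ∙ s) ≈⟨ ∙-congˡ (comm z s) ⟩
    y ∙ (s ∙ z) ≈⟨ assoc y s z ⟨
    y ∙ s ∙ z   ∎)

  ≋[]⇒≈ : ∀ {x y} → x ≋ y [mod [] ] → x ≈ y
  ≋[]⇒≈ {x} {y} (s , ∈[] s≈ε , x≈) = ≈-trans x≈ (≈-trans (∙-congˡ s≈ε) (identityʳ y))

  ·-%-≋ : ∀ {S g} R .{{_ : NonZero R}} a → R · g ∈⟨ S ⟩ → a · g ≋ (a % R) · g [mod S ]
  ·-%-≋ {g = g} R a R·g∈ = (a / R) · R · g , ·-∈ (a / R) R·g∈ , (begin
    a · g                           ≈⟨ ·-congˡ (m≡m%n+[m/n]*n a R) ⟩
    (a % R + a / R * R) · g         ≈⟨ ·-homo-+ g (a % R) (a / R * R) ⟩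
    (a % R) · g ∙ (a / R * R) · g   ≈⟨ ∙-congˡ (·-assoc g (a / R) R) ⟨
    (a % R) · g ∙ (a / R) · R · g   ∎)

  relativeOrder-∣ : ∀ {S g R} a d → RelativeOrder S g R → (a + d) · g ≋ a · g [mod S ] → R ∣ d
  relativeOrder-∣ {g = g} a d ro (s , s∈ , [a+d]g≈) =
    RelativeOrder.∣-kill ro d (∈-resp-≈ (≈-sym d·g≈s) s∈)
    where
    d·g≈s : d · g ≈ s
    d·g≈s = ∙-cancelˡ (a · g) (d · g) s (≈-trans (≈-sym (·-homo-+ g a d)) [a+d]g≈)

module TorsionSpan {c ℓ} (Γ : AbelianGroup c ℓ) (torsion : Span.IsTorsion Γ) where
  open AbelianGroupMultiples Γ
  open Span Γ
  module ≈-Reasoning = Relation.Binary.Reasoning.Setoid setoid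

  ⁻¹-∈ : ∀ {S x} → x ∈⟨ S ⟩ → x ⁻¹ ∈⟨ S ⟩
  ⁻¹-∈ {x = x} x∈ with torsion x
  ... | d , [1+d]x≈ε = ∈-resp-≈ (inverseʳ-unique x (d · x) [1+d]x≈ε) (·-∈ d x∈)

  ≋-sym : ∀ {S x y} → x ≋ y [mod S ] → y ≋ x [mod S ]
  ≋-sym {x = x} {y} (s , s∈ , x≈y∙s) = s ⁻¹ , ⁻¹-∈ s∈ , (begin
    y               ≈⟨ identityʳ y ⟨
    y ∙ ε           ≈⟨ ∙-congˡ (inverseʳ s) ⟨
    y ∙ (s ∙ s ⁻¹)  ≈⟨ assoc y s (s ⁻¹) ⟨
    y ∙ s ∙ s ⁻¹    ≈⟨ ∙-congʳ x≈y∙s ⟨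
    x ∙ s ⁻¹        ∎)
    where open ≈-Reasoning

  module ≋-Reasoning (S : List Carrier) where
    open import Relation.Binary.Reasoning.Syntax
    open begin-syntax _≋_[mod S ] id public
    open ≈-syntax _≋_[mod S ] _≋_[mod S ] (λ x≈y → ≋-trans (≈⇒≋ x≈y)) ≈-sym public
    open ≋-syntax _≋_[mod S ] _≋_[mod S ] ≋-trans ≋-sym public
    open end-syntax _≋_[mod S ] (≈⇒≋ ≈-refl) public

  ≋-dropˡ : ∀ {S a b x y} → a ∈⟨ S ⟩ → b ∈⟨ S ⟩ → a ∙ x ≋ b ∙ y [mod S ] → x ≋ y [mod S ]
  ≋-dropˡ {S} {a} {b} {x} {y} a∈ b∈ a∙x≋b∙y = begin
    x     ≋⟨ ∈⇒≋ a∈ ⟨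
    x ∙ a ≈⟨ comm x a ⟩
    a ∙ x ≋⟨ a∙x≋b∙y ⟩
    b ∙ y ≈⟨ comm b y ⟩
    y ∙ b ≋⟨ ∈⇒≋ b∈ ⟩
    y     ∎
    where open ≋-Reasoning S

  least⇒relativeOrder : ∀ {S g} r → suc r · g ∈⟨ S ⟩ → (∀ j → j < r → ¬ suc j · g ∈⟨ S ⟩) →
                        RelativeOrder S g (suc r)
  least⇒relativeOrder {S} {g} r kills below = record { kills = kills ; ∣-kill = ∣-kill }
    where
    no-smaller-killer : ∀ j → j < suc r → j · g ∈⟨ S ⟩ → j ≡ 0
    no-smaller-killer zero    _         _   = refl
    no-smaller-killer (suc j) (s≤s j<r) j∈ = contradiction j∈ (below j j<r)
    ∣-kill : ∀ k → k · g ∈⟨ S ⟩ → suc r ∣ k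
    ∣-kill k k·g∈ = m%n≡0⇒n∣m k (suc r) (no-smaller-killer (k % suc r) (m%n<n k (suc r))
                      (≋-∈ (≋-sym (·-%-≋ (suc r) k kills)) k·g∈))

  relativeOrder-cancel : ∀ {S g R a} e → RelativeOrder S g R → Coprime R a →
                         ∀ {i j} → i < R → j < R →
                         (e + a * i) · g ≋ (e + a * j) · g [mod S ] → i ≡ j
  relativeOrder-cancel {S} {g} {R} {a} e ro R⊥a {i} {j} = wlog ℕₚ.≤-total flip ordered i j
    where
    Cancels : ℕ → ℕ → Set (c ⊔ ℓ)
    Cancels i j = i < R → j < R → (e + a * i) · g ≋ (e + a * j) · g [mod S ] → i ≡ j
    flip : ∀ {i j} → Cancels i j → Cancels j i
    flip cancels j<R i<R eq = ≡.sym (cancels i<R j<R (≋-sym eq))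
    ordered : ∀ i j → i ≤ j → Cancels i j
    ordered i j i≤j _ j<R eq = ≡.trans (≡.sym (ℕₚ.+-identityʳ i))
      (≡.trans (≡.cong (i +_) (≡.sym d≡0)) (ℕₚ.m+[n∸m]≡n i≤j))
      where
      d = j ∸ i
      shift : e + a * j ≡ (e + a * i) + a * d
      shift = ≡.trans (≡.cong (λ t → e + a * t) (≡.sym (ℕₚ.m+[n∸m]≡n i≤j))) (distrib e a i d)
        where distrib : ∀ e a i d → e + a * (i + d) ≡ (e + a * i) + a * d
              distrib = solve-∀
      d≡0 : d ≡ 0
      d≡0 = ∣∧<⇒≡0 (coprime-divisor R⊥a (relativeOrder-∣ (e + a * i) (a * d) ro
              (≋-trans (≈⇒≋ (·-congˡ (≡.sym shift))) (≋-sym eq))))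
              (ℕₚ.≤-<-trans (ℕₚ.m∸n≤m j i) j<R)

  digitwise-injective : ∀ {S k R a B} .{{_ : NonZero B}} (e : ℕ → ℕ) (F G : ℕ → Carrier) →
    RelativeOrder S k R → Coprime R a →
    (∀ N → F N ≋ (e (N % B) + a * (N / B)) · k ∙ G (N % B) [mod S ]) →
    (∀ {j j′} → j < B → j′ < B → G j ≋ G j′ [mod k ∷ S ] → j ≡ j′) →
    ∀ {N M} → N < R * B → M < R * B → F N ≋ F M [mod S ] → N ≡ M
  digitwise-injective {S} {k} {R} {a} {B} e F G ro R⊥a split G-injective {N} {M} N<RB M<RB FN≋FM =
    begin
      N                 ≡⟨ m≡m%n+[m/n]*n N B ⟩
      N % B + N / B * B ≡⟨ ≡.cong₂ (λ j i → j + i * B) low≡ high≡ ⟩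
      M % B + M / B * B ≡⟨ m≡m%n+[m/n]*n M B ⟨
      M                 ∎
    where
    open ≡.≡-Reasoning
    coefficient : ℕ → ℕ
    coefficient N = e (N % B) + a * (N / B)
    split≋ : coefficient N · k ∙ G (N % B) ≋ coefficient M · k ∙ G (M % B) [mod S ]
    split≋ = ≋-trans (≋-sym (split N)) (≋-trans FN≋FM (split M))
    low≡ : N % B ≡ M % B
    low≡ = G-injective (m%n<n N B) (m%n<n M B)
             (≋-dropˡ (generator-∈ k (coefficient N)) (generator-∈ k (coefficient M))
                      (≋-∷ k split≋))
    high≡ : N / B ≡ M / B
    high≡ = relativeOrder-cancel (e (N % B)) ro R⊥a (m<n*o⇒m/o<n N<RB) (m<n*o⇒m/o<n M<RB)
              (≋-cancelʳ (≡.subst (λ j → _ ≋ (e j + a * (M / B)) · k ∙ G j [mod S ])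
                                  (≡.sym low≡) split≋))

  rep-injective : ∀ {S ks N M} → Series S ks → N < index ks → M < index ks →
                  rep ks N ≋ rep ks M [mod S ] → N ≡ M
  rep-injective []                              (s≤s z≤n) (s≤s z≤n) _ = refl
  rep-injective {ks = (k , r) ∷ ks} (ro ∷ series) =
    digitwise-injective (λ _ → 0) (rep ((k , r) ∷ ks)) (rep ks) ro
      (Coprimality.sym (1-coprimeTo (suc r)))
      (λ N → ≈⇒≋ (∙-congʳ (·-congˡ (≡.sym (ℕₚ.*-identityˡ (N / index ks))))))
      (rep-injective series)
    where instance _ = index-nonZero ks

  rep-surjective : ∀ {S ks x} → Series S ks → x ∈⟨ S ◂ ks ⟩ →
                   ∃ λ N → N < index ks × x ≋ rep ks N [mod S ]
  rep-surjective {x = x} [] x∈ = 0 , s≤s z≤n , (x , x∈ , ≈-sym (identityˡ x))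
  rep-surjective {S} {(k , r) ∷ ks} {x} (ro ∷ series) x∈ with rep-surjective series x∈
  ... | j , j<B , (s , ∈∷ t a t∈ s≈t∙a·k , x≈) =
    j + (a % suc r) * index ks , j+i*B<R*B j<B (m%n<n a (suc r)) , (begin
      x                          ≈⟨ x≈ ⟩
      rep ks j ∙ s               ≈⟨ ∙-congˡ s≈t∙a·k ⟩
      rep ks j ∙ (t ∙ a · k)     ≈⟨ x∙yz≈zx∙y (rep ks j) t (a · k) ⟩
      a · k ∙ rep ks j ∙ t       ≋⟨ ∈⇒≋ t∈ ⟩
      a · k ∙ rep ks j           ≋⟨ ∙-≋ (·-%-≋ (suc r) a (RelativeOrder.kills ro)) (≈⇒≋ ≈-refl) ⟩
      (a % suc r) · k ∙ rep ks j ≈⟨ rep-digits k r ks {i = a % suc r} j<B ⟨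
      rep ((k , r) ∷ ks) (j + (a % suc r) * index ks) ∎)
    where open ≋-Reasoning S

  adjacentSum : Gens → ℕ → Carrier
  adjacentSum ks N = rep ks N ∙ rep ks (suc N % index ks)
    where instance _ = index-nonZero ks

  module _ {S : List Carrier} {k : Carrier} {r : ℕ} {ks : Gens} where
    private instance
      B≢0  = index-nonZero ks
      RB≢0 = index-nonZero ((k , r) ∷ ks)

    rep-periodic : suc r · k ∈⟨ S ⟩ → ∀ N →
                   rep ((k , r) ∷ ks) (N % index ((k , r) ∷ ks)) ≋ rep ((k , r) ∷ ks) N [mod S ]
    rep-periodic kills N = begin
      ((N % (suc r * B)) / B) · k ∙ rep ks (N % (suc r * B) % B)
        ≈⟨ ∙-cong (·-congˡ (m%[n*o]/o≡m/o%n N (suc r) B))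
                  (≈-reflexive (≡.cong (rep ks) (m∣n⇒o%n%m≡o%m B (suc r * B) N (n∣m*n (suc r))))) ⟩
      (N / B % suc r) · k ∙ rep ks (N % B)
        ≋⟨ ∙-≋ (·-%-≋ (suc r) (N / B) kills) (≈⇒≋ ≈-refl) ⟨
      (N / B) · k ∙ rep ks (N % B) ∎
      where
      B = index ks
      open ≋-Reasoning S

    -- The carry suc (N % index ks) / index ks is 1 exactly when the low digits of N are
    -- all maximal.
    adjacentSum-∷ : suc r · k ∈⟨ S ⟩ → ∀ N →
      adjacentSum ((k , r) ∷ ks) N
        ≋ (suc (N % index ks) / index ks + 2 * (N / index ks)) · k ∙ adjacentSum ks (N % index ks)
        [mod S ]
    adjacentSum-∷ kills N = begin
      rep ((k , r) ∷ ks) N ∙ rep ((k , r) ∷ ks) (suc N % index ((k , r) ∷ ks))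
        ≋⟨ ∙-≋ (≈⇒≋ ≈-refl) (rep-periodic kills (suc N)) ⟩
      i · k ∙ rep ks j ∙ ((suc N / B) · k ∙ rep ks (suc N % B))
        ≈⟨ ∙-congˡ (∙-cong (·-congˡ high) (≈-reflexive (≡.cong (rep ks) low))) ⟩
      i · k ∙ rep ks j ∙ ((suc j / B + i) · k ∙ rep ks (suc j % B))
        ≈⟨ interchange (i · k) (rep ks j) _ _ ⟩
      (i · k ∙ (suc j / B + i) · k) ∙ adjacentSum ks j
        ≈⟨ ∙-congʳ (≈-trans (≈-sym (·-homo-+ k i _)) (·-congˡ (digits (suc j / B) i))) ⟩
      (suc j / B + 2 * i) · k ∙ adjacentSum ks j ∎
      where
      B = index ks
      j = N % B
      i = N / B
      open ≋-Reasoning S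
      1+N≡ : suc N ≡ suc j + i * B
      1+N≡ = ≡.cong suc (m≡m%n+[m/n]*n N B)
      high : suc N / B ≡ suc j / B + i
      high = ≡.trans (/-congˡ {o = B} 1+N≡) ([j+i*B]/B≡j/B+i (suc j) i B)
      low : suc N % B ≡ suc j % B
      low = ≡.trans (%-congˡ {o = B} 1+N≡) ([m+kn]%n≡m%n (suc j) i B)
      digits : ∀ δ i → i + (δ + i) ≡ δ + 2 * i
      digits = solve-∀

  adjacentSum-injective : ∀ {S ks N M} → Series S ks → ¬ 2 ∣ index ks →
                          N < index ks → M < index ks →
                          adjacentSum ks N ≋ adjacentSum ks M [mod S ] → N ≡ M
  adjacentSum-injective []                              _ (s≤s z≤n) (s≤s z≤n) _ = refl
  adjacentSum-injective {ks = (k , r) ∷ ks} (ro ∷ series) odd =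
    digitwise-injective (λ j → suc j / index ks) (adjacentSum ((k , r) ∷ ks)) (adjacentSum ks) ro
      (¬2∣⇒coprime-2 (λ 2∣R → odd (∣-trans 2∣R (m∣m*n (index ks)))))
      (adjacentSum-∷ {k = k} {r} {ks} (RelativeOrder.kills ro))
      (adjacentSum-injective series (λ 2∣B → odd (∣-trans 2∣B (n∣m*n (suc r)))))
    where instance _ = index-nonZero ks

module FiniteAbelianGroup {c ℓ} (Γ : AbelianGroup c ℓ) {q : ℕ} (|Γ|≡q : HasOrder Γ q) where
  open AbelianGroupMultiples Γ
  open Span Γ
  open Inverse (Bijection⇒Inverse |Γ|≡q) using (to; from; from-cong; strictlyInverseˡ)
  open Relation.Binary.Reasoning.Setoid setoid

  instance
    q-nonZero : NonZero q
    q-nonZero = Fin⇒nonZero (from ε)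

  from-injective : ∀ {x y} → from x ≡ from y → x ≈ y
  from-injective {x} {y} eq = begin
    x           ≈⟨ strictlyInverseˡ x ⟨
    to (from x) ≡⟨ ≡.cong to eq ⟩
    to (from y) ≈⟨ strictlyInverseˡ y ⟩
    y           ∎

  _≈?_ : ∀ x y → Dec (x ≈ y)
  x ≈? y = map′ from-injective from-cong (from x Finₚ.≟ from y)

  torsion : IsTorsion
  torsion x =
    let i , j , i<j , same = Finₚ.pigeonhole (ℕₚ.n<1+n q) (λ i → from (toℕ i · x))
        a = toℕ i
        d = toℕ j ∸ suc a
        j≡1+d+a : toℕ j ≡ suc d + a
        j≡1+d+a = ≡.trans (≡.sym (ℕₚ.m∸n+n≡m i<j)) (ℕₚ.+-suc d a)
    in d , ∙-cancelʳ (a · x) (suc d · x) ε (begin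
      suc d · x ∙ a · x ≈⟨ ·-homo-+ x (suc d) a ⟨
      (suc d + a) · x   ≡⟨ ≡.cong (_· x) j≡1+d+a ⟨
      toℕ j · x         ≈⟨ from-injective same ⟨
      a · x             ≈⟨ identityˡ (a · x) ⟨
      ε ∙ a · x         ∎)

  open TorsionSpan Γ torsion

  injective⇒surjective : (f : Fin q → Carrier) → (∀ {i j} → f i ≈ f j → i ≡ j) →
                         ∀ y → ∃ λ i → f i ≈ y
  injective⇒surjective f f-injective y =
    let i , from-fi≡from-y = Fin-injective⇒surjective (λ i → from (f i))
                               (λ eq → f-injective (from-injective eq)) (from y)
    in i , from-injective from-fi≡from-y

  index≤order : ∀ {hs} → Series [] hs → index hs ≤ q
  index≤order {hs} series = Finₚ.injective⇒≤ {f = λ i → from (rep hs (toℕ i))} λ eq →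
    Finₚ.toℕ-injective
      (rep-injective series (Finₚ.toℕ<n _) (Finₚ.toℕ<n _) (≈⇒≋ (from-injective eq)))

  ∈⇒rep : ∀ {hs x} → Series [] hs → x ∈⟨ [] ◂ hs ⟩ →
          ∃ λ (i : Fin (index hs)) → x ≈ rep hs (toℕ i)
  ∈⇒rep {hs} series x∈ =
    let N , N< , x≋ = rep-surjective series x∈
    in Fin.fromℕ< N< ,
       ≈-trans (≋[]⇒≈ x≋) (≈-reflexive (≡.cong (rep hs) (≡.sym (Finₚ.toℕ-fromℕ< N<))))

  generating⇒order≤index : ∀ {hs} → Series [] hs → (∀ x → x ∈⟨ [] ◂ hs ⟩) → q ≤ index hs
  generating⇒order≤index {hs} series generates =
    Finₚ.injective⇒≤ {f = coordinate} coordinate-injective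
    where
    coordinate : Fin q → Fin (index hs)
    coordinate y = proj₁ (∈⇒rep series (generates (to y)))
    coordinate-injective : ∀ {y y′} → coordinate y ≡ coordinate y′ → y ≡ y′
    coordinate-injective {y} {y′} eq = Bijection.injective |Γ|≡q (begin
      to y                          ≈⟨ proj₂ (∈⇒rep series (generates (to y))) ⟩
      rep hs (toℕ (coordinate y))   ≡⟨ ≡.cong (λ i → rep hs (toℕ i)) eq ⟩
      rep hs (toℕ (coordinate y′))  ≈⟨ proj₂ (∈⇒rep series (generates (to y′))) ⟨
      to y′                         ∎)

  infix 4 _∈?⟨_⟩
  _∈?⟨_⟩ : ∀ {hs} x → Series [] hs → Dec (x ∈⟨ [] ◂ hs ⟩)
  _∈?⟨_⟩ {hs} x series = map′
    (λ (i , rep≈x) → ∈-resp-≈ rep≈x (rep-∈ [] hs (toℕ i)))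
    (λ x∈ → let i , x≈rep = ∈⇒rep series x∈ in i , ≈-sym x≈rep)
    (Finₚ.any? (λ i → rep hs (toℕ i) ≈? x))

  generates? : ∀ {hs} → Series [] hs → (∀ x → x ∈⟨ [] ◂ hs ⟩) ⊎ ∃ λ x → ¬ x ∈⟨ [] ◂ hs ⟩
  generates? {hs} series = case Finₚ.all? (λ i → to i ∈?⟨ series ⟩) of λ where
    (yes all-in) → inj₁ (λ x → ∈-resp-≈ (strictlyInverseˡ x) (all-in (from x)))
    (no ¬all-in) →
      let i , to-i∉ = Finₚ.¬∀⟶∃¬ q (λ i → to i ∈⟨ [] ◂ hs ⟩) (λ i → to i ∈?⟨ series ⟩) ¬all-in
      in inj₂ (to i , to-i∉)

  relativeOrder : ∀ {hs} → Series [] hs → ∀ x → ∃ λ r → RelativeOrder ([] ◂ hs) x (suc r)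
  relativeOrder series x =
    let d , [1+d]x≈ε = torsion x
        r , kills , below = least-witness (λ r → suc r · x ∈?⟨ series ⟩) d
                              (∈-resp-≈ (≈-sym [1+d]x≈ε) (ε-∈ _))
    in r , least⇒relativeOrder r kills below

  adjoin : ∀ {hs x} → Series [] hs → ¬ x ∈⟨ [] ◂ hs ⟩ →
           ∃ λ r → RelativeOrder ([] ◂ hs) x (suc r) × index hs < index (hs ∷ʳ (x , r))
  adjoin {hs} {x} series x∉ =
    let r , ro = relativeOrder series x
    in r , ro , ℕₚ.<-≤-trans
         (ℕₚ.m<m*n (index hs) (suc r) {{index-nonZero hs}} (∉⇒1<relativeOrder x∉ ro))
         (ℕₚ.≤-reflexive (≡.sym (index-∷ʳ hs x r)))

  -- The budget bounds the number of extensions: each one strictly increases the index.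
  complete : ∀ budget {hs} → Series [] hs → q ≤ index hs + budget →
             ∃ λ ks → Series ([] ◂ hs) ks × index hs * index ks ≡ q
  complete zero {hs} series q≤ = [] , [] , ≡.trans (ℕₚ.*-identityʳ (index hs))
    (ℕₚ.≤-antisym (index≤order series) (ℕₚ.≤-trans q≤ (ℕₚ.≤-reflexive (ℕₚ.+-identityʳ (index hs)))))
  complete (suc budget) {hs} series q≤ = case generates? series of λ where
    (inj₁ generates) →
      [] , [] , ≡.trans (ℕₚ.*-identityʳ (index hs))
                  (ℕₚ.≤-antisym (index≤order series) (generating⇒order≤index series generates))
    (inj₂ (x , x∉)) →
      let r , ro , grows = adjoin series x∉
          ks , ks-series , index≡ = complete budget (Series-∷ʳ series ro) (budget-step grows q≤)
      in (x , r) ∷ ks , ro ∷ ≡.subst (λ S → Series S ks) (◂-∷ʳ [] hs x r) ks-series ,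
         ≡.trans (≡.sym (index-∷ʳ-* hs x r (index ks))) index≡

  index∣order : ∀ {hs} → Series [] hs → index hs ∣ q
  index∣order series =
    let ks , _ , index≡ = complete q series (ℕₚ.m≤n+m q _)
    in divides (index ks) (≡.trans (≡.sym index≡) (ℕₚ.*-comm _ (index ks)))

  order·x≈ε : ∀ x → q · x ≈ ε
  order·x≈ε x =
    let r , ro = relativeOrder [] x
        divides t q≡t*R*1 = index∣order (ro ∷ [])
        t·R·x≈q·x : t · suc r · x ≈ q · x
        t·R·x≈q·x = begin
          t · suc r · x         ≡⟨ ≡.cong (λ R → t · R · x) (ℕₚ.*-identityʳ (suc r)) ⟨
          t · (suc r * 1) · x   ≈⟨ ·-assoc x t (suc r * 1) ⟩
          (t * (suc r * 1)) · x ≡⟨ ≡.cong (_· x) q≡t*R*1 ⟨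
          q · x                 ∎
    in ∈[]⇒≈ε (∈-resp-≈ t·R·x≈q·x (·-∈ t (RelativeOrder.kills ro)))

  ·-cancel : ∀ {a x y} → a ∣ suc q → a · x ≈ a · y → x ≈ y
  ·-cancel {a} {x} {y} (divides t 1+q≡t*a) a·x≈a·y = begin
    x           ≈⟨ 1+order·z≈z x ⟨
    suc q · x   ≡⟨ ≡.cong (_· x) 1+q≡t*a ⟩
    (t * a) · x ≈⟨ ·-assoc x t a ⟨
    t · a · x   ≈⟨ ·-congʳ t a·x≈a·y ⟩
    t · a · y   ≈⟨ ·-assoc y t a ⟩
    (t * a) · y ≡⟨ ≡.cong (_· y) 1+q≡t*a ⟨
    suc q · y   ≈⟨ 1+order·z≈z y ⟩
    y           ∎
    where
    1+order·z≈z : ∀ z → suc q · z ≈ z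
    1+order·z≈z z = ≈-trans (∙-congˡ (order·x≈ε z)) (identityʳ z)

  index<order : ∀ {hs p} → Prime p → index hs * p ∣ q → index hs < q
  index<order {hs} {p} p-prime index*p∣q = ℕₚ.<-≤-trans
    (ℕₚ.m<m*n (index hs) p {{index-nonZero hs}} (ℕ.nonTrivial⇒n>1 p {{prime⇒nonTrivial p-prime}}))
    (∣⇒≤ index*p∣q)

  adjoin-preserves-∣ : ∀ {hs x r p} → Series [] hs → RelativeOrder ([] ◂ hs) x (suc r) →
                       Prime p → ¬ p ∣ suc r → index hs * p ∣ q → index (hs ∷ʳ (x , r)) * p ∣ q
  adjoin-preserves-∣ {hs} {x} {r} {p} series ro p-prime p∤R index*p∣q =
    ≡.subst (λ i → i * p ∣ q) (≡.sym (index-∷ʳ hs x r))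
      (prime-∣-cofactor {{index-nonZero hs}} p-prime p∤R
        (≡.subst (_∣ q) (index-∷ʳ hs x r) (index∣order (Series-∷ʳ series ro))) index*p∣q)

  cauchy : ∀ budget {hs p} → Series [] hs → q ≤ index hs + budget → Prime p → index hs * p ∣ q →
           ∃ λ g → RelativeOrder ([] ◂ hs) g p
  cauchy zero {hs} series q≤ p-prime index*p∣q = contradiction
    (ℕₚ.≤-trans q≤ (ℕₚ.≤-reflexive (ℕₚ.+-identityʳ (index hs))))
    (ℕₚ.<⇒≱ (index<order {hs} p-prime index*p∣q))
  cauchy (suc budget) {hs} {p} series q≤ p-prime index*p∣q = case generates? series of λ where
    (inj₁ generates) → contradiction (generating⇒order≤index series generates)
                                     (ℕₚ.<⇒≱ (index<order {hs} p-prime index*p∣q))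
    (inj₂ (x , x∉)) → let r , ro , grows = adjoin series x∉ in case p ∣? suc r of λ where
      (yes (divides s@(suc _) R≡s*p)) →
        s · x , relativeOrder-multiple s (≡.subst (RelativeOrder ([] ◂ hs) x) R≡s*p ro)
      (no p∤R) →
        let y , y-ro = cauchy budget (Series-∷ʳ series ro) (budget-step grows q≤) p-prime
                         (adjoin-preserves-∣ series ro p-prime p∤R index*p∣q)
            y-ro′ = ≡.subst (λ S → RelativeOrder S y p) (◂-∷ʳ [] hs x r) y-ro
        in suc r · y , relativeOrder-lift ro y-ro′ p-prime p∤R

  adjoin-primes : ∀ {hs} → Series [] hs → ∀ ps → All Prime ps → index hs * product ps ∣ q →
                  ∃ λ hs′ → Series [] hs′ × index hs′ ≡ index hs * product ps
  adjoin-primes {hs} series []           []            _ =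
    hs , series , ≡.sym (ℕₚ.*-identityʳ (index hs))
  adjoin-primes      series (zero ∷ _)   (0-prime ∷ _) _ = contradiction 0-prime ¬prime[0]
  adjoin-primes {hs} series (suc p ∷ ps) (p-prime ∷ ps-prime) index*∏∣q =
    let g , g-ro = cauchy q series (ℕₚ.m≤n+m q _) p-prime
                     (∣-trans (*-monoʳ-∣ (index hs) (m∣m*n (product ps))) index*∏∣q)
        hs′ , series′ , index≡ =
          adjoin-primes (Series-∷ʳ series g-ro) ps ps-prime
                        (≡.subst (_∣ q) (≡.sym (index-∷ʳ-* hs g p (product ps))) index*∏∣q)
    in hs′ , series′ , ≡.trans index≡ (index-∷ʳ-* hs g p (product ps))

  subgroup-of-order : ∀ m .{{_ : NonZero m}} → m ∣ q → ∃ λ hs → Series [] hs × index hs ≡ m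
  subgroup-of-order m m∣q =
    let record { factors = ps ; isFactorisation = m≡∏ps ; factorsPrime = ps-prime } = factorise m
        hs , series , index≡ = adjoin-primes [] ps ps-prime
                                 (≡.subst (_∣ q) (≡.trans m≡∏ps (≡.sym (ℕₚ.*-identityˡ _))) m∣q)
    in hs , series , ≡.trans index≡ (≡.trans (ℕₚ.*-identityˡ _) (≡.sym m≡∏ps))

module Windmill {c ℓ} (Γ : AbelianGroup c ℓ) {n m : ℕ} (|Γ|≡mn : HasOrder Γ (m * n)) where
  open AbelianGroupMultiples Γ
  open Span Γ
  open FiniteAbelianGroup Γ |Γ|≡mn
  open TorsionSpan Γ torsion
  open Relation.Binary.Reasoning.Setoid setoid

  module Labelling (1<n : 1 < n) (n-odd : ¬ 2 ∣ n) (2∣1+mn : 2 ∣ suc (m * n))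
                   {hs ks} (hs-series : Series [] hs) (ks-series : Series ([] ◂ hs) ks)
                   (index-hs≡m : index hs ≡ m) (index-ks≡n : index ks ≡ n) where
    instance
      n-nonZero : NonZero n
      n-nonZero = ℕ.>-nonZero (ℕₚ.<-trans (s≤s z≤n) 1<n)
      B-nonZero : NonZero (index ks)
      B-nonZero = index-nonZero ks

    H : List Carrier
    H = [] ◂ hs

    h : Fin m → Carrier
    h i = rep hs (toℕ i)

    h-∈ : ∀ i → h i ∈⟨ H ⟩
    h-∈ i = rep-∈ [] hs (toℕ i)

    h-injective : ∀ {i j} → h i ≈ h j → i ≡ j
    h-injective {i} {j} hi≈hj =
      Finₚ.toℕ-injective (rep-injective hs-series (<index i) (<index j) (≈⇒≋ hi≈hj))
      where
      <index : ∀ i → toℕ i < index hs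
      <index i = ≡.subst (toℕ i <_) (≡.sym index-hs≡m) (Finₚ.toℕ<n i)

    L : ℕ → Carrier
    L = rep ks

    <n⇒<index : ∀ {p} → p < n → p < index ks
    <n⇒<index = ≡.subst (_ <_) (≡.sym index-ks≡n)

    position : WVertex n m → ℕ
    position (inj₁ _)       = 0
    position (inj₂ (_ , t)) = suc (toℕ t)

    offset : WVertex n m → Carrier
    offset (inj₁ _)       = ε
    offset (inj₂ (i , _)) = h i

    label : WVertex n m → Carrier
    label v = offset v ∙ L (position v)

    position<n : ∀ v → position v < n
    position<n (inj₁ _)       = ℕₚ.<-trans (s≤s z≤n) 1<n
    position<n (inj₂ (_ , t)) = <∸1⇒suc< (Finₚ.toℕ<n t)

    offset-∈ : ∀ v → offset v ∈⟨ H ⟩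
    offset-∈ (inj₁ _)       = ε-∈ H
    offset-∈ (inj₂ (i , _)) = h-∈ i

    label-injective : ∀ {u v} → label u ≈ label v → u ≡ v
    label-injective {u} {v} lu≈lv = same-vertex u v same-position lu≈lv
      where
      same-position : position u ≡ position v
      same-position =
        rep-injective ks-series (<n⇒<index (position<n u)) (<n⇒<index (position<n v))
                      (≋-dropˡ (offset-∈ u) (offset-∈ v) (≈⇒≋ lu≈lv))
      same-vertex : ∀ u v → position u ≡ position v → label u ≈ label v → u ≡ v
      same-vertex (inj₁ _)       (inj₁ _)         _        _     = refl
      same-vertex (inj₁ _)       (inj₂ _)         ()       _
      same-vertex (inj₂ _)       (inj₁ _)         ()       _
      same-vertex (inj₂ (i , t)) (inj₂ (i′ , t′)) 1+t≡1+t′ lu≈lv =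
        ≡.cong inj₂ (≡.cong₂ _,_ i≡i′ t≡t′)
        where
        t≡t′ : t ≡ t′
        t≡t′ = Finₚ.toℕ-injective (ℕₚ.suc-injective 1+t≡1+t′)
        i≡i′ : i ≡ i′
        i≡i′ = h-injective (∙-cancelʳ (L (suc (toℕ t))) (h i) (h i′)
                 (≈-trans lu≈lv (∙-congˡ (≈-reflexive (≡.cong L (≡.sym 1+t≡1+t′))))))

    -- The same case split as cycleVertex: 1 away from the centre, 0 at the centre.
    inner : ℕ → ℕ
    inner zero = 0
    inner (suc p) with p ℕ.<? n ∸ 1
    ... | yes _ = 1
    ... | no  _ = 0

    offset-cycleVertex : ∀ i p → offset (cycleVertex n i p) ≈ inner p · h i
    offset-cycleVertex i zero = ≈-refl
    offset-cycleVertex i (suc p) with p ℕ.<? n ∸ 1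
    ... | yes _ = ≈-sym (·-identityˡ (h i))
    ... | no  _ = ≈-refl

    position-cycleVertex : ∀ i p → p ≤ n → position (cycleVertex n i p) ≡ p % index ks
    position-cycleVertex i zero _ = ≡.sym (m<n⇒m%n≡m (<n⇒<index (ℕₚ.<-trans (s≤s z≤n) 1<n)))
    position-cycleVertex i (suc p) 1+p≤n with p ℕ.<? n ∸ 1
    ... | yes p<n-1 = ≡.trans (≡.cong suc (Finₚ.toℕ-fromℕ< p<n-1))
                              (≡.sym (m<n⇒m%n≡m (<n⇒<index (<∸1⇒suc< p<n-1))))
    ... | no  p≮n-1 =
      ≡.sym (≡.trans (≡.cong (_% index ks) (≡.trans 1+p≡n (≡.sym index-ks≡n))) (n%n≡0 (index ks)))
      where
      1+p≡n : suc p ≡ n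
      1+p≡n = ℕₚ.≤-antisym 1+p≤n (≡.subst (_≤ suc p) (ℕₚ.suc-pred n) (s≤s (ℕₚ.≮⇒≥ p≮n-1)))

    weight : ℕ → ℕ
    weight p = inner p + inner (suc p)

    weight∣1+mn : ∀ p → p < n → weight p ∣ suc (m * n)
    weight∣1+mn zero _ with 0 ℕ.<? n ∸ 1
    ... | yes _     = 1∣ _
    ... | no  0≮n-1 = contradiction (ℕₚ.m<n⇒0<n∸m 1<n) 0≮n-1
    weight∣1+mn (suc p) 1+p<n with p ℕ.<? n ∸ 1 | suc p ℕ.<? n ∸ 1
    ... | yes _     | yes _ = 2∣1+mn
    ... | yes _     | no  _ = 1∣ _
    ... | no  p≮n-1 | _     = contradiction (ℕₚ.∸-monoˡ-< 1+p<n (s≤s z≤n)) p≮n-1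

    edgeLabel : Fin m × Fin n → Carrier
    edgeLabel (i , j) = label (cycleVertex n i (toℕ j)) ∙ label (cycleVertex n i (suc (toℕ j)))

    edgeLabel≈ : ∀ i j → edgeLabel (i , j) ≈ weight (toℕ j) · h i ∙ adjacentSum ks (toℕ j)
    edgeLabel≈ i j = begin
      label u ∙ label v
        ≈⟨ interchange (offset u) (L (position u)) (offset v) (L (position v)) ⟩
      (offset u ∙ offset v) ∙ (L (position u) ∙ L (position v))
        ≈⟨ ∙-cong (∙-cong (offset-cycleVertex i p) (offset-cycleVertex i (suc p)))
                  (∙-cong (≈-reflexive (≡.cong L position-u)) (≈-reflexive (≡.cong L position-v))) ⟩
      (inner p · h i ∙ inner (suc p) · h i) ∙ adjacentSum ks p
        ≈⟨ ∙-congʳ (·-homo-+ (h i) (inner p) (inner (suc p))) ⟨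
      weight p · h i ∙ adjacentSum ks p
        ∎
      where
      p = toℕ j
      p<n = Finₚ.toℕ<n j
      u = cycleVertex n i p
      v = cycleVertex n i (suc p)
      position-u : position u ≡ p
      position-u = ≡.trans (position-cycleVertex i p (ℕₚ.<⇒≤ p<n)) (m<n⇒m%n≡m (<n⇒<index p<n))
      position-v : position v ≡ suc p % index ks
      position-v = position-cycleVertex i (suc p) p<n

    edgeLabel-injective : ∀ {e e′} → edgeLabel e ≈ edgeLabel e′ → e ≡ e′
    edgeLabel-injective {i , j} {i′ , j′} e≈e′ = ≡.cong₂ _,_ i≡i′ j≡j′
      where
      p = toℕ j
      p′ = toℕ j′
      split≈ : weight p · h i ∙ adjacentSum ks p ≈ weight p′ · h i′ ∙ adjacentSum ks p′
      split≈ = ≈-trans (≈-sym (edgeLabel≈ i j)) (≈-trans e≈e′ (edgeLabel≈ i′ j′))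
      p≡p′ : p ≡ p′
      p≡p′ = adjacentSum-injective ks-series (≡.subst (λ B → ¬ 2 ∣ B) (≡.sym index-ks≡n) n-odd)
               (<n⇒<index (Finₚ.toℕ<n j)) (<n⇒<index (Finₚ.toℕ<n j′))
               (≋-dropˡ (·-∈ (weight p) (h-∈ i)) (·-∈ (weight p′) (h-∈ i′)) (≈⇒≋ split≈))
      j≡j′ : j ≡ j′
      j≡j′ = Finₚ.toℕ-injective p≡p′
      weighted≈ : weight p · h i ≈ weight p · h i′
      weighted≈ = ∙-cancelʳ (adjacentSum ks p) _ _
        (≡.subst (λ t → weight p · h i ∙ adjacentSum ks p ≈ weight t · h i′ ∙ adjacentSum ks t)
                 (≡.sym p≡p′) split≈)
      i≡i′ : i ≡ i′
      i≡i′ = h-injective (·-cancel (weight∣1+mn p (Finₚ.toℕ<n j)) weighted≈)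

    edgeLabel-surjective : ∀ y → ∃ λ e → ∀ {e′} → e′ ≡ e → edgeLabel e′ ≈ y
    edgeLabel-surjective y =
      let z , ≈y = injective⇒surjective (λ z → edgeLabel (Fin.remQuot n z))
                     (λ eq → remQuot-injective (edgeLabel-injective eq)) y
      in Fin.remQuot n z , λ { refl → ≈y }
      where
      remQuot-injective : ∀ {z z′} → Fin.remQuot {m} n z ≡ Fin.remQuot n z′ → z ≡ z′
      remQuot-injective = Injection.injective (Inverse⇒Injection (Finₚ.*↔× {m} {n}))

    harmonious : IsHarmonious (DutchWindmill n m) Γ
    harmonious = label , label-injective , edgeLabel-injective , edgeLabel-surjective

  harmonious : 1 < n → n % 2 ≡ 1 → m % 2 ≡ 1 → IsHarmonious (DutchWindmill n m) Γ
  harmonious 1<n n-odd m-odd =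
    let hs , hs-series , index-hs≡m = subgroup-of-order m {{m≢0}} (m∣m*n n)
        ks , ks-series , index-hs*index-ks≡mn = complete (m * n) hs-series (ℕₚ.m≤n+m (m * n) _)
        index-ks≡n = ℕₚ.*-cancelˡ-≡ (index ks) n m {{m≢0}}
                       (≡.trans (≡.cong (_* index ks) (≡.sym index-hs≡m)) index-hs*index-ks≡mn)
    in Labelling.harmonious 1<n (odd⇒¬2∣ n-odd) (odd⇒2∣suc (odd*odd {m} {n} m-odd n-odd))
                            hs-series ks-series index-hs≡m index-ks≡n
    where
    m≢0 : NonZero m
    m≢0 = odd⇒nonZero m-odd

theorem6p2 : ∀ {c ℓ : Level} (n m : ℕ) → n ≥ 3 → m ≥ 3 → n % 2 ≡ 1 → m % 2 ≡ 1 →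
    (Γ : AbelianGroup c ℓ) → HasOrder Γ (m * n) → IsHarmonious (DutchWindmill n m) Γ
theorem6p2 n m n≥3 _ n-odd m-odd Γ |Γ|≡mn =
  Windmill.harmonious Γ |Γ|≡mn (ℕₚ.≤-trans (ℕₚ.n≤1+n 2) n≥3) n-odd m-odd
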